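{- Let $r\ge1$, $s\ge3$, and $k_1,\dots,k_{s-1},\ell\in[r]$. Then $(\omega_{k_1},\dots,\omega_{k_{s-1}},\omega_\ell)\in\mathsf{EqLR}_r^s$ if and only if $k_i\le\ell$ for all $i\in[s-1]$ and $\sum_{i=1}^{s-1}k_i\ge\ell$.
   Context: Points of $\mathbb{R}^{rs}$ are written $(\lambda^1,\dots,\lambda^{s-1},\nu)$ with $\lambda^j,\nu\in\mathbb{R}^r$; $|\lambda|=\sum_i\lambda_i$; $\lambda\subseteq\mu$ means $\lambda_i\le\mu_i$ for all $i$. For $j\in[r]$, $\omega_j=(1,\dots,1,0,\dots,0)\in\mathbb{R}^r$ with $j$ ones. $\tau(\{i_1<\dots<i_e\})=(i_e-e\ge\dots\ge i_1-1)$; $c^{L}_{J_1,\dots,J_{s-1}}$ (for $e$-element sets) is the coefficient of $[X_{\tau(L)}]$ in $[X_{\tau(J_1)}]\cdots[X_{\tau(J_{s-1})}]$ in $H^*(\mathrm{Gr}(e,\mathbb{C}^n))$, $n$ large. $\mathsf{EqLR}_r^s$ is the set of points with: each $\lambda^j,\nu$ weakly decreasing; $\lambda^j_r\ge0$ for all $j$; $\lambda^j\subseteq\nu$ for all $j$; $\sum_j|\lambda^j|\ge|\nu|$; and $\sum_j\sum_{a\in J_j}\lambda^j_a\ge\sum_{k\in L}\nu_k$ for every $1\le e<r$ and $e$-subsets $J_1,\dots,J_{s-1},L\subseteq[r]$ with $c^L_{J_1,\dots,J_{s-1}}=1$. -}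

module Defs where

open import Data.Nat using (ℕ; zero; suc; _+_; _*_; _∸_; _≤ᵇ_; _<ᵇ_; _≡ᵇ_)
open import Data.Bool using (Bool; true; false; _∧_; if_then_else_)
open import Data.Fin using (Fin; toℕ)
open import Data.Fin.Subset using (Subset; ∣_∣)
open import Data.Vec using (Vec; []; _∷_; lookup)
open import Data.List using (List; []; _∷_; map; concatMap; upTo; allFin; reverse; filter; length; foldr)
open import Data.Nat.ListAction using (sum)
open import Data.Bool.ListAction using (and)
import Data.List as L
open import Data.Integer using (ℤ; 0ℤ; _≤_) renaming (_+_ to _+ℤ_)
open import Data.Product using (_×_)
open import Relation.Binary.PropositionalEquality using (_≡_)
open import Data.Nat.Base using () renaming (_≤_ to _≤ℕ_)

sumF : (n : ℕ) → (Fin n → ℕ) → ℕ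
sumF n f = sum (map f (allFin n))

sumBelow : (n : ℕ) → ℕ → (Fin n → ℕ) → ℕ
sumBelow n m f = sum (map (λ k → if toℕ k <ᵇ m then f k else 0) (allFin n))

allᵇ : (n : ℕ) → (Fin n → Bool) → Bool
allᵇ n p = and (map p (allFin n))

countᵇ : {A : Set} → (A → Bool) → List A → ℕ
countᵇ p xs = length (filter (λ x → Data.Bool.T? (p x)) xs)
  where import Data.Bool

boxVecs : (n B : ℕ) → List (Vec ℕ n)
boxVecs zero B = [] ∷ []
boxVecs (suc n) B = concatMap (λ x → map (x ∷_) (boxVecs n B)) (upTo (suc B))

decrᵇ : {n : ℕ} → Vec ℕ n → Bool
decrᵇ [] = true
decrᵇ (x ∷ []) = true
decrᵇ (x ∷ y ∷ v) = (y ≤ᵇ x) ∧ decrᵇ (y ∷ v)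

eqVecᵇ : {n : ℕ} → Vec ℕ n → Vec ℕ n → Bool
eqVecᵇ [] [] = true
eqVecᵇ (x ∷ u) (y ∷ v) = (x ≡ᵇ y) ∧ eqVecᵇ u v

zeros : (n : ℕ) → Vec ℕ n
zeros zero = []
zeros (suc n) = 0 ∷ zeros n

-- Littlewood–Richardson coefficients for partitions with at most e rows
-- (partitions are stored as length-e vectors, padded with zeros).
--
-- An LR tableau of shape ν/λ and weight μ is encoded (as usual) by its
-- content matrix a : row i ↦ value k ↦ (number of entries k+1 in row i+1),
-- rows/values 0-indexed.  Rows are weakly increasing, so a determines the
-- tableau.  Conditions:
--   * row i has ν_i − λ_i boxes:            λ_i + Σ_k a i k = ν_i
--   * weight μ:                             Σ_i a i k = μ_k
--   * columns strictly increase (i ≥ 1):    λ_i + Σ_{k'≤k} a i k'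
--                                             ≤ λ_{i-1} + Σ_{k'<k} a (i-1) k'
--   * reverse reading word is a lattice word:
--       Σ_{i'≤i} a i' (k+1) ≤ Σ_{i'<i} a i' k
-- Entries of a are bounded by |μ|, so the enumeration is finite.

isLRᵇ : (e : ℕ) → (ν lm μ : Vec ℕ e) → (Fin e → Fin e → ℕ) → Bool
isLRᵇ e ν lm μ a =
  allᵇ e (λ i → (lookup lm i + sumF e (a i)) ≡ᵇ lookup ν i)
  ∧ allᵇ e (λ k → sumF e (λ i → a i k) ≡ᵇ lookup μ k)
  ∧ allᵇ e (λ i → allᵇ e (λ i' → if suc (toℕ i') ≡ᵇ toℕ i
        then allᵇ e (λ k →
               (lookup lm i + sumBelow e (suc (toℕ k)) (a i))
                 ≤ᵇ (lookup lm i' + sumBelow e (toℕ k) (a i')))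
        else true))
  ∧ allᵇ e (λ i → allᵇ e (λ k → allᵇ e (λ k' → if suc (toℕ k) ≡ᵇ toℕ k'
        then sumBelow e (suc (toℕ i)) (λ i'' → a i'' k')
               ≤ᵇ sumBelow e (toℕ i) (λ i'' → a i'' k)
        else true)))

boxMats : (e B : ℕ) → List (Vec (Vec ℕ e) e)
boxMats e B = go e
  where
  go : (m : ℕ) → List (Vec (Vec ℕ e) m)
  go zero = [] ∷ []
  go (suc m) = concatMap (λ row → map (row ∷_) (go m)) (boxVecs e B)

-- c^ν_{λ μ}: number of LR tableaux of shape ν/λ and weight μ
LR : (e : ℕ) → (ν lm μ : Vec ℕ e) → ℕ
LR e ν lm μ =
  countᵇ (λ m → isLRᵇ e ν lm μ (λ i k → lookup (lookup m i) k))
         (boxMats e (sumF e (lookup μ)))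

partsBelow : (e B : ℕ) → List (Vec ℕ e)
partsBelow e B = filter (λ v → Data.Bool.T? (decrᵇ v)) (boxVecs e B)
  where import Data.Bool

-- multiple LR coefficient c^ν_{λ¹,…,λᵐ} = coefficient of s_ν in s_{λ¹}⋯s_{λᵐ},
-- computed by iterating the two-factor coefficient (intermediate
-- partitions κ satisfy κ ⊆ ν, so parts ≤ |ν| suffice).
multiLR : (e : ℕ) → Vec ℕ e → List (Vec ℕ e) → ℕ
multiLR e ν [] = if eqVecᵇ ν (zeros e) then 1 else 0
multiLR e ν (l₁ ∷ rest) = go l₁ rest
  where
  go : Vec ℕ e → List (Vec ℕ e) → ℕ
  go acc [] = if eqVecᵇ ν acc then 1 else 0
  go acc (μ ∷ rest') =
    sum (map (λ κ → LR e κ acc μ * go κ rest') (partsBelow e (sumF e (lookup ν))))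

-- τ(J) for J = {i₁<⋯<i_e} ⊆ [r]:  τ(J) = (i_e − e ≥ ⋯ ≥ i₁ − 1).
-- i_p − p is the number of non-elements of J below i_p.

tausAux : {r : ℕ} → ℕ → Subset r → List ℕ
tausAux c [] = []
tausAux c (true ∷ bs) = c ∷ tausAux c bs
tausAux c (false ∷ bs) = tausAux (suc c) bs

padTo : (e : ℕ) → List ℕ → Vec ℕ e
padTo zero _ = []
padTo (suc e) [] = 0 ∷ padTo e []
padTo (suc e) (x ∷ xs) = x ∷ padTo e xs

-- τ(J) as a partition with e rows (used when ∣ J ∣ ≡ e)
τ : {r : ℕ} → (e : ℕ) → Subset r → Vec ℕ e
τ e J = padTo e (reverse (tausAux 0 J))

-- Schubert structure constant c^L_{J₁,…,J_m} in H*(Gr(e, ℂⁿ)), n large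
cSchubert : {r : ℕ} → (e m : ℕ) → (Fin m → Subset r) → Subset r → ℕ
cSchubert e m J L = multiLR e (τ e L) (map (λ j → τ e (J j)) (allFin m))

sumℤ : (n : ℕ) → (Fin n → ℤ) → ℤ
sumℤ n f = foldr (λ k acc → f k +ℤ acc) 0ℤ (allFin n)

sumOn : {r : ℕ} → Subset r → (Fin r → ℤ) → ℤ
sumOn {r} J v = sumℤ r (λ a → if lookup J a then v a else 0ℤ)

WeaklyDecr : {r : ℕ} → (Fin r → ℤ) → Set
WeaklyDecr {r} v = (a b : Fin r) → toℕ a ≤ℕ toℕ b → v b ≤ v a

EqLR : (r s : ℕ) → (Fin (s ∸ 1) → Fin r → ℤ) → (Fin r → ℤ) → Set
EqLR r s lams ν =
    ((j : Fin (s ∸ 1)) → WeaklyDecr (lams j))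
  × WeaklyDecr ν
  × ((j : Fin (s ∸ 1)) (a : Fin r) → suc (toℕ a) ≡ r → 0ℤ ≤ lams j a)
  × ((j : Fin (s ∸ 1)) (a : Fin r) → lams j a ≤ ν a)
  × (sumℤ r ν ≤ sumℤ (s ∸ 1) (λ j → sumℤ r (lams j)))
  × ((e : ℕ) → 1 ≤ℕ e → suc e ≤ℕ r →
       (J : Fin (s ∸ 1) → Subset r) (L : Subset r) →
       ((j : Fin (s ∸ 1)) → ∣ J j ∣ ≡ e) → ∣ L ∣ ≡ e →
       cSchubert e (s ∸ 1) J L ≡ 1 →
       sumOn L ν ≤ sumℤ (s ∸ 1) (λ j → sumOn (J j) (lams j)))

ω : (r j : ℕ) → Fin r → ℤ
ω r j a = if toℕ a <ᵇ j then Data.Integer.+ 1 else 0ℤ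
  where import Data.Integer

{-# OPTIONS --safe #-}
module Submission where

-- Necessity is read off from the conditions λʲ ⊆ ν and Σⱼ |λʲ| ≥ |ν|.  For sufficiency only the
-- Horn inequalities need work, and for fundamental weights they read |L ∩ [ℓ]| ≤ Σⱼ |Jⱼ ∩ [kⱼ]|.
-- For a partition v with e parts let N_K(v) be the number of p < e with v_{e−p} + p + 1 ≤ K, so
-- that N_K(τ(J)) = |J ∩ [K]|.  If c^κ_{αβ} ≠ 0 then α_{e−p} + β_{e−q} ≤ κ_{e−p−q}, a Weyl-type
-- inequality that follows on an LR tableau from the lattice and column-strictness conditions; it
-- makes N subadditive: N_{K+K′}(κ) ≤ N_K(α) + N_{K′}(β).  Iterating this along the product defining
-- c^L_{J₁,…,J_{s−1}}, and using ℓ ≤ Σⱼ kⱼ and monotonicity of N_K in K, gives the Horn inequality.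

open import Defs
open import Data.Bool using (Bool; true; false; T; T?; _∧_; if_then_else_)
open import Data.Bool.ListAction using (and)
open import Data.Bool.Properties using (T-∧)
open import Data.Empty using (⊥-elim)
open import Data.Fin using (Fin; toℕ; fromℕ<) renaming (zero to fzero; suc to fsuc)
open import Data.Fin.Properties using (toℕ-fromℕ<; toℕ<n)
open import Data.Fin.Subset using (Subset; ∣_∣)
open import Data.Integer as ℤ using (ℤ; 0ℤ; +≤+)
open import Data.Integer.Properties using (drop‿+≤+)
open import Data.List using (List; []; _∷_; map; allFin; tabulate; filter; length; reverse; reverseAcc; foldr)
open import Data.List.Membership.Propositional.Properties using (∈-allFin)
open import Data.List.Properties using (map-tabulate; map-cong)
open import Data.List.Relation.Unary.All as All using (All; []; _∷_)
open import Data.Nat using (ℕ; zero; suc; _+_; _*_; _∸_; _≤_; _<_; z≤n; s≤s; _≤ᵇ_; _<ᵇ_; _≤?_)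
open import Data.Nat.ListAction using (sum)
open import Data.Nat.Properties
open import Data.Nat.Tactic.RingSolver using (solve-∀)
open import Data.Product using (_×_; _,_; ∃; ∃-syntax; proj₂)
open import Data.Vec using (Vec; []; _∷_; lookup)
open import Function using (_∘_; Equivalence)
open import Function.Bundles using (_⇔_; mk⇔)
open import Level using (0ℓ)
open import Relation.Binary.PropositionalEquality
open import Relation.Nullary using (¬_; yes; no)
open import Relation.Unary using (Pred; Decidable)

∑< : ℕ → (ℕ → ℕ) → ℕ
∑< zero    f = 0
∑< (suc n) f = ∑< n f + f n

infix 7 ∑<
syntax ∑< n (λ i → x) = ∑[ i < n ] x

𝟙 : Bool → ℕ
𝟙 b = if b then 1 else 0

if-T : ∀ {A : Set} {b} {x y : A} → T b → (if b then x else y) ≡ x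
if-T {b = true} _ = refl

if-¬T : ∀ {A : Set} {b} {x y : A} → ¬ T b → (if b then x else y) ≡ y
if-¬T {b = true}  ¬t = ⊥-elim (¬t _)
if-¬T {b = false} _  = refl

≤⇒¬<ᵇ : ∀ {m n} → m ≤ n → ¬ T (n <ᵇ m)
≤⇒¬<ᵇ {m} {n} m≤n t = ≤⇒≯ m≤n (<ᵇ⇒< n m t)

∑-cong : ∀ n {f g : ℕ → ℕ} → (∀ i → i < n → f i ≡ g i) → ∑< n f ≡ ∑< n g
∑-cong zero    f≡g = refl
∑-cong (suc n) f≡g = cong₂ _+_ (∑-cong n (λ i i<n → f≡g i (m<n⇒m<1+n i<n))) (f≡g n ≤-refl)

∑-unfoldˡ : ∀ n (f : ℕ → ℕ) → ∑< (suc n) f ≡ f 0 + ∑[ i < n ] f (suc i)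
∑-unfoldˡ zero    f = +-comm 0 (f 0)
∑-unfoldˡ (suc n) f = begin
  ∑< (suc n) f + f (suc n)                ≡⟨ cong (_+ f (suc n)) (∑-unfoldˡ n f) ⟩
  f 0 + ∑[ i < n ] f (suc i) + f (suc n)  ≡⟨ +-assoc (f 0) _ _ ⟩
  f 0 + ∑[ i < suc n ] f (suc i)          ∎
  where open ≡-Reasoning

∑-mono-≤ : ∀ n {f g : ℕ → ℕ} → (∀ i → f i ≤ g i) → ∑< n f ≤ ∑< n g
∑-mono-≤ zero    f≤g = z≤n
∑-mono-≤ (suc n) f≤g = +-mono-≤ (∑-mono-≤ n f≤g) (f≤g n)

∑-monoˡ-≤ : ∀ {m n} (f : ℕ → ℕ) → m ≤ n → ∑< m f ≤ ∑< n f
∑-monoˡ-≤ {m} {zero}  f z≤n = ≤-refl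
∑-monoˡ-≤ {m} {suc n} f m≤1+n with m ≤? n
... | yes m≤n = ≤-trans (∑-monoˡ-≤ f m≤n) (m≤m+n _ (f n))
... | no  m≰n rewrite ≤-antisym m≤1+n (≰⇒> m≰n) = ≤-refl

∑-1 : ∀ n → ∑[ _ < n ] 1 ≡ n
∑-1 zero    = refl
∑-1 (suc n) = trans (cong (_+ 1) (∑-1 n)) (+-comm n 1)

∑-<ᵇ : ∀ {m} n (f : ℕ → ℕ) → m ≤ n → ∑[ i < n ] (if i <ᵇ m then f i else 0) ≡ ∑< m f
∑-<ᵇ zero f z≤n = refl
∑-<ᵇ {m} (suc n) f m≤1+n with m ≤? n
... | yes m≤n = begin
  ∑[ i < n ] (if i <ᵇ m then f i else 0) + (if n <ᵇ m then f n else 0)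
    ≡⟨ cong₂ _+_ (∑-<ᵇ n f m≤n) (if-¬T (≤⇒¬<ᵇ m≤n)) ⟩
  ∑< m f + 0
    ≡⟨ +-identityʳ _ ⟩
  ∑< m f ∎
  where open ≡-Reasoning
... | no m≰n rewrite ≤-antisym m≤1+n (≰⇒> m≰n) =
  ∑-cong (suc n) (λ i i<1+n → if-T (<⇒<ᵇ i<1+n))

𝟙≤1 : ∀ b → 𝟙 b ≤ 1
𝟙≤1 true  = ≤-refl
𝟙≤1 false = z≤n

𝟙-mono : ∀ {b b′} → (T b → T b′) → 𝟙 b ≤ 𝟙 b′
𝟙-mono {false}        _    = z≤n
𝟙-mono {true} {true}  _    = ≤-refl
𝟙-mono {true} {false} b⇒b′ = ⊥-elim (b⇒b′ _)

𝟙-mono⁻ : ∀ {b b′} → 𝟙 b ≤ 𝟙 b′ → T b → T b′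
𝟙-mono⁻ {true} {true} _ _ = _

∑-𝟙-≤ : ∀ n (b : ℕ → Bool) → ∑[ i < n ] 𝟙 (b i) ≤ n
∑-𝟙-≤ n b = subst (∑[ i < n ] 𝟙 (b i) ≤_) (∑-1 n) (∑-mono-≤ n (λ i → 𝟙≤1 (b i)))

∑-𝟙-≤-from : ∀ n {p} (b : ℕ → Bool) → (∀ i → p ≤ i → ¬ T (b i)) → ∑[ i < n ] 𝟙 (b i) ≤ p
∑-𝟙-≤-from zero    b _ = z≤n
∑-𝟙-≤-from (suc n) {p} b false-from-p with p ≤? n
... | yes p≤n = begin
  ∑[ i < n ] 𝟙 (b i) + 𝟙 (b n) ≡⟨ cong (∑[ i < n ] 𝟙 (b i) +_) (if-¬T (false-from-p n p≤n)) ⟩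
  ∑[ i < n ] 𝟙 (b i) + 0       ≡⟨ +-identityʳ _ ⟩
  ∑[ i < n ] 𝟙 (b i)           ≤⟨ ∑-𝟙-≤-from n b false-from-p ⟩
  p                            ∎
  where open ≤-Reasoning
... | no p≰n = ≤-trans (∑-𝟙-≤ (suc n) b) (≰⇒> p≰n)

∑-𝟙-<-witness : ∀ n (b : ℕ → Bool) → ∑[ i < n ] 𝟙 (b i) < n → ∃[ i ] i < n × ¬ T (b i)
∑-𝟙-<-witness (suc n) b sum<1+n with T? (b n)
... | no ¬bn = n , ≤-refl , ¬bn
... | yes bn =
  let sum<n = ≤-pred (subst (_< suc n) (trans (cong (∑[ i < n ] 𝟙 (b i) +_) (if-T bn)) (+-comm _ 1)) sum<1+n)
      (i , i<n , ¬bi) = ∑-𝟙-<-witness n b sum<n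
  in i , m<n⇒m<1+n i<n , ¬bi

sum-allFin-suc : ∀ {n} (g : Fin (suc n) → ℕ) →
                 sum (map g (allFin (suc n))) ≡ g fzero + sum (map (g ∘ fsuc) (allFin n))
sum-allFin-suc g =
  cong (λ xs → g fzero + sum xs) (trans (map-tabulate fsuc g) (sym (map-tabulate (λ i → i) (g ∘ fsuc))))

sum-allFin : ∀ n {g : Fin n → ℕ} {G : ℕ → ℕ} → (∀ i → g i ≡ G (toℕ i)) → sum (map g (allFin n)) ≡ ∑< n G
sum-allFin zero    _   = refl
sum-allFin (suc n) {g} {G} g≡G = begin
  sum (map g (allFin (suc n)))              ≡⟨ sum-allFin-suc g ⟩
  g fzero + sum (map (g ∘ fsuc) (allFin n)) ≡⟨ cong₂ _+_ (g≡G fzero) (sum-allFin n (g≡G ∘ fsuc)) ⟩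
  G 0 + ∑[ i < n ] G (suc i)                ≡⟨ ∑-unfoldˡ n G ⟨
  ∑< (suc n) G                              ∎
  where open ≡-Reasoning

sumBelow-∑ : ∀ {n m} {f : Fin n → ℕ} {F : ℕ → ℕ} → m ≤ n → (∀ i → f i ≡ F (toℕ i)) → sumBelow n m f ≡ ∑< m F
sumBelow-∑ {n} {m} {F = F} m≤n f≡F =
  trans (sum-allFin n (λ i → cong (if toℕ i <ᵇ m then_else 0) (f≡F i))) (∑-<ᵇ n F m≤n)

T-and-map : ∀ {A : Set} (p : A → Bool) xs → T (and (map p xs)) → All (T ∘ p) xs
T-and-map p []       _ = []
T-and-map p (x ∷ xs) t = let (px , pxs) = Equivalence.to T-∧ t in px ∷ T-and-map p xs pxs

T-allᵇ : ∀ {n} {p : Fin n → Bool} → T (allᵇ n p) → ∀ i → T (p i)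
T-allᵇ {n} {p} t i = All.lookup (T-and-map p (allFin n) t) (∈-allFin i)

extend : ∀ {n} → (Fin n → ℕ) → ℕ → ℕ
extend {zero}  f i       = 0
extend {suc n} f zero    = f fzero
extend {suc n} f (suc i) = extend (f ∘ fsuc) i

extend-toℕ : ∀ {n} (f : Fin n → ℕ) i → extend f (toℕ i) ≡ f i
extend-toℕ f fzero    = refl
extend-toℕ f (fsuc i) = extend-toℕ (f ∘ fsuc) i

infixl 9 _‼_
_‼_ : ∀ {n} → Vec ℕ n → ℕ → ℕ
v ‼ i = extend (lookup v) i

∀-below : ∀ {n} (P : ℕ → Set) → (∀ (i : Fin n) → P (toℕ i)) → ∀ {i} → i < n → P i
∀-below P h i<n = subst P (toℕ-fromℕ< i<n) (h (fromℕ< i<n))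

∀-below³ : ∀ {n} (P : ℕ → ℕ → ℕ → Set) → (∀ (i j k : Fin n) → P (toℕ i) (toℕ j) (toℕ k)) →
           ∀ {i j k} → i < n → j < n → k < n → P i j k
∀-below³ P h i<n j<n k<n =
  ∀-below (λ i → P i _ _) (λ I → ∀-below (λ j → P (toℕ I) j _) (λ J → ∀-below (P (toℕ I) (toℕ J)) (h I J) k<n) j<n) i<n

T-∧⁴ : ∀ {a b c d} → T (a ∧ b ∧ c ∧ d) → T a × T b × T c × T d
T-∧⁴ t = let (ta , tbcd) = Equivalence.to T-∧ t ; (tb , tcd) = Equivalence.to T-∧ tbcd
         in ta , tb , Equivalence.to T-∧ tcd

-- The content matrix of isLRᵇ, extended by zero to all of ℕ × ℕ: a i k counts the entries k in row i.
record LRTableau (e : ℕ) (ν α β : Vec ℕ e) : Set where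
  field
    a             : ℕ → ℕ → ℕ
    row-length    : ∀ i → i < e → α ‼ i + ∑< e (a i) ≡ ν ‼ i
    content       : ∀ k → k < e → ∑[ i < e ] a i k ≡ β ‼ k
    column-strict : ∀ i k → suc i < e → k < e → α ‼ suc i + ∑< (suc k) (a (suc i)) ≤ α ‼ i + ∑< k (a i)
    lattice       : ∀ i k → i < e → suc k < e → ∑[ j < suc i ] a j (suc k) ≤ ∑[ j < i ] a j k

isLRᵇ⇒LRTableau : ∀ {e ν α β} (a : Fin e → Fin e → ℕ) → T (isLRᵇ e ν α β a) → LRTableau e ν α β
isLRᵇ⇒LRTableau {e} {ν} {α} {β} a t with T-∧⁴ t
... | rows , contents , columns , lattice-word = record
  { a             = A
  ; row-length    = λ i → ∀-below (λ i → α ‼ i + ∑< e (A i) ≡ ν ‼ i) row-length-Fin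
  ; content       = λ k → ∀-below (λ k → ∑[ i < e ] A i k ≡ β ‼ k) content-Fin
  ; column-strict = λ i k si<e k<e →
      ∀-below³ (λ i₁ i₀ k → suc i₀ ≡ i₁ → α ‼ i₁ + ∑< (suc k) (A i₁) ≤ α ‼ i₀ + ∑< k (A i₀))
               column-strict-Fin si<e (<⇒≤ si<e) k<e refl
  ; lattice       = λ i k i<e sk<e →
      ∀-below³ (λ i k k′ → suc k ≡ k′ → ∑[ j < suc i ] A j k′ ≤ ∑[ j < i ] A j k)
               lattice-Fin i<e (<⇒≤ sk<e) sk<e refl
  }
  where
  A : ℕ → ℕ → ℕ
  A i k = extend (λ I → extend (a I) k) i

  A-toℕ : ∀ I K → a I K ≡ A (toℕ I) (toℕ K)
  A-toℕ I K = sym (trans (extend-toℕ (λ I → extend (a I) (toℕ K)) I) (extend-toℕ (a I) K))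

  row-prefix : ∀ I {m} → m ≤ e → lookup α I + sumBelow e m (a I) ≡ α ‼ toℕ I + ∑< m (A (toℕ I))
  row-prefix I m≤e = cong₂ _+_ (sym (extend-toℕ (lookup α) I)) (sumBelow-∑ m≤e (A-toℕ I))

  column-prefix : ∀ K {m} → m ≤ e → sumBelow e m (λ I → a I K) ≡ ∑[ i < m ] A i (toℕ K)
  column-prefix K m≤e = sumBelow-∑ m≤e (λ I → A-toℕ I K)

  row-length-Fin : ∀ I → α ‼ toℕ I + ∑< e (A (toℕ I)) ≡ ν ‼ toℕ I
  row-length-Fin I = begin
    α ‼ toℕ I + ∑< e (A (toℕ I)) ≡⟨ cong₂ _+_ (extend-toℕ (lookup α) I) (sym (sum-allFin e (A-toℕ I))) ⟩
    lookup α I + sumF e (a I)    ≡⟨ ≡ᵇ⇒≡ _ _ (T-allᵇ rows I) ⟩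
    lookup ν I                   ≡⟨ extend-toℕ (lookup ν) I ⟨
    ν ‼ toℕ I                    ∎
    where open ≡-Reasoning

  content-Fin : ∀ K → ∑[ i < e ] A i (toℕ K) ≡ β ‼ toℕ K
  content-Fin K = begin
    ∑[ i < e ] A i (toℕ K)    ≡⟨ sum-allFin e (λ I → A-toℕ I K) ⟨
    sumF e (λ I → a I K)      ≡⟨ ≡ᵇ⇒≡ _ _ (T-allᵇ contents K) ⟩
    lookup β K                ≡⟨ extend-toℕ (lookup β) K ⟨
    β ‼ toℕ K                 ∎
    where open ≡-Reasoning

  column-strict-Fin : ∀ I I′ K → suc (toℕ I′) ≡ toℕ I →
                      α ‼ toℕ I + ∑< (suc (toℕ K)) (A (toℕ I)) ≤ α ‼ toℕ I′ + ∑< (toℕ K) (A (toℕ I′))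
  column-strict-Fin I I′ K I′+1≡I =
    subst₂ _≤_ (row-prefix I (toℕ<n K)) (row-prefix I′ (<⇒≤ (toℕ<n K)))
      (≤ᵇ⇒≤ _ _ (T-allᵇ (subst T (if-T (≡⇒≡ᵇ _ _ I′+1≡I)) (T-allᵇ (T-allᵇ columns I) I′)) K))

  lattice-Fin : ∀ I K K′ → suc (toℕ K) ≡ toℕ K′ →
                ∑[ j < suc (toℕ I) ] A j (toℕ K′) ≤ ∑[ j < toℕ I ] A j (toℕ K)
  lattice-Fin I K K′ K+1≡K′ =
    subst₂ _≤_ (column-prefix K′ (toℕ<n I)) (column-prefix K (<⇒≤ (toℕ<n I)))
      (≤ᵇ⇒≤ _ _ (subst T (if-T (≡⇒≡ᵇ _ _ K+1≡K′)) (T-allᵇ (T-allᵇ (T-allᵇ lattice-word I) K) K′)))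

filter-nonempty : ∀ {A : Set} {P : Pred A 0ℓ} (P? : Decidable P) xs → length (filter P? xs) ≢ 0 → ∃ P
filter-nonempty P? []       len≢0 = ⊥-elim (len≢0 refl)
filter-nonempty P? (x ∷ xs) len≢0 with P? x
... | yes px = x , px
... | no  _  = filter-nonempty P? xs len≢0

LR≢0⇒LRTableau : ∀ {e ν α β} → LR e ν α β ≢ 0 → LRTableau e ν α β
LR≢0⇒LRTableau {e} {ν} {α} {β} LR≢0 =
  let (M , isLR) = filter-nonempty (λ M → T? (isLRᵇ e ν α β (λ i k → lookup (lookup M i) k)))
                                   (boxMats e (sumF e (lookup β))) LR≢0
  in isLRᵇ⇒LRTableau (λ i k → lookup (lookup M i) k) isLR

module _ {e ν α β} (t : LRTableau e ν α β) where
  open LRTableau t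

  entriesAbove : ℕ → ℕ → ℕ
  entriesAbove q k = ∑[ i < q ] a i k

  prefixEnd : ℕ → ℕ → ℕ
  prefixEnd k i = α ‼ i + ∑< k (a i)

  entriesAbove-shift : ∀ d q k → q + d ≤ e → k + d < e → entriesAbove (q + d) (k + d) ≤ entriesAbove q k
  entriesAbove-shift zero q k _ _ rewrite +-identityʳ q | +-identityʳ k = ≤-refl
  entriesAbove-shift (suc d) q k q+d<e k+d+1<e rewrite +-suc q d | +-suc k d =
    ≤-trans (lattice (q + d) (k + d) q+d<e k+d+1<e)
            (entriesAbove-shift d q k (<⇒≤ q+d<e) (<⇒≤ k+d+1<e))

  no-entry-k-above-row-k : ∀ k → k < e → entriesAbove k k ≡ 0
  no-entry-k-above-row-k k k<e = n≤0⇒n≡0 (entriesAbove-shift k 0 0 (<⇒≤ k<e) k<e)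

  prefixEnd-telescope : ∀ k d → k + d < e →
                        prefixEnd k (k + d) + entriesAbove (suc (k + d)) k ≤ prefixEnd k k + entriesAbove (suc k) k
  prefixEnd-telescope k zero _ rewrite +-identityʳ k = ≤-refl
  prefixEnd-telescope k (suc d) k+d+1<e rewrite +-suc k d = begin
    prefixEnd k (suc i) + (entriesAbove (suc i) k + a (suc i) k)  ≡⟨ regroup (α ‼ suc i) _ _ _ ⟩
    prefixEnd (suc k) (suc i) + entriesAbove (suc i) k            ≤⟨ +-monoˡ-≤ _ (column-strict i k k+d+1<e k<e) ⟩
    prefixEnd k i + entriesAbove (suc i) k                        ≤⟨ prefixEnd-telescope k d (<⇒≤ k+d+1<e) ⟩
    prefixEnd k k + entriesAbove (suc k) k                        ∎
    where
    open ≤-Reasoning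
    i : ℕ
    i = k + d
    k<e : k < e
    k<e = ≤-<-trans (m≤m+n k (suc d)) (subst (_< e) (sym (+-suc k d)) k+d+1<e)
    regroup : ∀ x y z w → (x + y) + (z + w) ≡ (x + (y + w)) + z
    regroup = solve-∀

  -- By the lattice condition there are at least β ‼ (k + p) entries k in rows ≤ k + q, and column
  -- strictness stacks these, together with α ‼ (k + q), into row k of ν.
  weyl-inequality : ∀ k p q → suc (k + q) + p ≡ e → α ‼ (k + q) + β ‼ (k + p) ≤ ν ‼ k
  weyl-inequality k p q e≡ = begin
    α ‼ i + β ‼ (k + p)                     ≤⟨ +-monoʳ-≤ (α ‼ i) β-bound ⟩
    α ‼ i + entriesAbove (suc i) k          ≤⟨ +-monoˡ-≤ _ (m≤m+n (α ‼ i) _) ⟩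
    prefixEnd k i + entriesAbove (suc i) k  ≤⟨ prefixEnd-telescope k q i<e ⟩
    prefixEnd k k + entriesAbove (suc k) k  ≡⟨ cong (λ n → prefixEnd k k + (n + a k k)) (no-entry-k-above-row-k k k<e) ⟩
    prefixEnd k k + a k k                   ≡⟨ +-assoc (α ‼ k) _ _ ⟩
    α ‼ k + ∑< (suc k) (a k)                ≤⟨ +-monoʳ-≤ (α ‼ k) (∑-monoˡ-≤ (a k) k<e) ⟩
    α ‼ k + ∑< e (a k)                      ≡⟨ row-length k k<e ⟩
    ν ‼ k                                   ∎
    where
    open ≤-Reasoning
    i : ℕ
    i = k + q
    i<e : i < e
    i<e = ≤-trans (s≤s (m≤m+n i p)) (≤-reflexive e≡)
    k<e : k < e
    k<e = ≤-<-trans (m≤m+n k q) i<e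
    k+p<e : k + p < e
    k+p<e = ≤-trans (s≤s (+-monoˡ-≤ p (m≤m+n k q))) (≤-reflexive e≡)
    β-bound : β ‼ (k + p) ≤ entriesAbove (suc i) k
    β-bound = begin
      β ‼ (k + p)                       ≡⟨ content (k + p) k+p<e ⟨
      entriesAbove e (k + p)            ≡⟨ cong (λ n → entriesAbove n (k + p)) e≡ ⟨
      entriesAbove (suc i + p) (k + p)  ≤⟨ entriesAbove-shift p (suc i) k (≤-reflexive e≡) k+p<e ⟩
      entriesAbove (suc i) k            ∎

-- For v = τ e J this is the (p+1)-st smallest element of J, counting the elements of [r] from 1.
shiftedPart : ∀ {e} → Vec ℕ e → ℕ → ℕ
shiftedPart {e} v p = suc p + v ‼ (e ∸ suc p)

shiftedPart-weyl : ∀ {e ν α β} → LRTableau e ν α β → ∀ p q → p + q < e →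
                   shiftedPart α p + shiftedPart β q ≤ suc (shiftedPart ν (p + q))
shiftedPart-weyl {ν = ν} {α} {β} t p q p+q<e with m≤n⇒∃[o]m+o≡n p+q<e
... | c , refl = begin
  suc p + α ‼ (e ∸ suc p) + (suc q + β ‼ (e ∸ suc q))
    ≡⟨ cong₂ (λ i j → suc p + α ‼ i + (suc q + β ‼ j)) (cancel p q)
             (trans (cong (λ n → suc n + c ∸ suc q) (+-comm p q)) (cancel q p)) ⟩
  suc p + α ‼ (c + q) + (suc q + β ‼ (c + p))
    ≡⟨ regroup p q (α ‼ (c + q)) (β ‼ (c + p)) ⟩
  suc (suc (p + q) + (α ‼ (c + q) + β ‼ (c + p)))
    ≤⟨ s≤s (+-monoʳ-≤ (suc (p + q)) (weyl-inequality t c p q (reorder c p q))) ⟩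
  suc (suc (p + q) + ν ‼ c)
    ≡⟨ cong (λ i → suc (suc (p + q) + ν ‼ i)) (m+n∸m≡n (suc (p + q)) c) ⟨
  suc (shiftedPart ν (p + q)) ∎
  where
  open ≤-Reasoning
  e : ℕ
  e = suc (p + q) + c
  cancel : ∀ x y → suc (x + y) + c ∸ suc x ≡ c + y
  cancel x y = trans (cong (_∸ x) (+-assoc x y c)) (trans (m+n∸m≡n x (y + c)) (+-comm y c))
  regroup : ∀ m n x y → suc m + x + (suc n + y) ≡ suc (suc (m + n) + (x + y))
  regroup = solve-∀
  reorder : ∀ l m n → suc (l + n) + m ≡ suc (m + n) + l
  reorder = solve-∀

shiftedParts≤ : ∀ {e} → ℕ → Vec ℕ e → ℕ
shiftedParts≤ {e} K v = ∑[ p < e ] 𝟙 (shiftedPart v p ≤ᵇ K)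

shiftedParts≤-mono : ∀ {e K K′} (v : Vec ℕ e) → K ≤ K′ → shiftedParts≤ K v ≤ shiftedParts≤ K′ v
shiftedParts≤-mono {e} v K≤K′ = ∑-mono-≤ e (λ p → 𝟙-mono (λ t → ≤⇒≤ᵇ (≤-trans (≤ᵇ⇒≤ _ _ t) K≤K′)))

decrᵇ-antitone : ∀ {n} (v : Vec ℕ n) → T (decrᵇ v) → ∀ {i j} → i ≤ j → v ‼ j ≤ v ‼ i
decrᵇ-antitone []          _ _ = ≤-refl
decrᵇ-antitone (x ∷ [])    _ {zero}  {zero}  _ = ≤-refl
decrᵇ-antitone (x ∷ [])    _ {zero}  {suc j} _ = z≤n
decrᵇ-antitone (x ∷ [])    _ {suc i} {suc j} _ = ≤-refl
decrᵇ-antitone (x ∷ y ∷ v) t {zero}  {zero}  _ = ≤-refl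
decrᵇ-antitone (x ∷ y ∷ v) t {zero}  {suc j} _ =
  let (y≤x , decr) = Equivalence.to T-∧ t
  in ≤-trans (decrᵇ-antitone (y ∷ v) decr {zero} {j} z≤n) (≤ᵇ⇒≤ y x y≤x)
decrᵇ-antitone (x ∷ y ∷ v) t {suc i} {suc j} (s≤s i≤j) =
  decrᵇ-antitone (y ∷ v) (proj₂ (Equivalence.to T-∧ t)) i≤j

shiftedPart-mono : ∀ {e} (v : Vec ℕ e) → T (decrᵇ v) → ∀ {p p′} → p ≤ p′ → shiftedPart v p ≤ shiftedPart v p′
shiftedPart-mono {e} v decr p≤p′ = +-mono-≤ (s≤s p≤p′) (decrᵇ-antitone v decr (∸-monoʳ-≤ e (s≤s p≤p′)))

shiftedPart>-witness : ∀ {e} K (v : Vec ℕ e) → shiftedParts≤ K v < e →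
                       ∃[ p ] p ≤ shiftedParts≤ K v × K < shiftedPart v p
shiftedPart>-witness {e} K v count<e =
  let (p , p<1+count , ¬p≤K) = ∑-𝟙-<-witness (suc (shiftedParts≤ K v)) (λ p → shiftedPart v p ≤ᵇ K)
                                 (s≤s (∑-monoˡ-≤ (λ p → 𝟙 (shiftedPart v p ≤ᵇ K)) count<e))
  in p , ≤-pred p<1+count , ≰⇒> (¬p≤K ∘ ≤⇒≤ᵇ)

-- If the shifted parts p of α and q of β exceed K and K′, then by shiftedPart-weyl all shifted
-- parts of κ from p + q on exceed K + K′.
shiftedParts≤-subadditive : ∀ {e κ α β} → LRTableau e κ α β → T (decrᵇ κ) → ∀ K K′ →
                            shiftedParts≤ (K + K′) κ ≤ shiftedParts≤ K α + shiftedParts≤ K′ β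
shiftedParts≤-subadditive {e} {κ} {α} {β} t decr K K′ with e ≤? shiftedParts≤ K α + shiftedParts≤ K′ β
... | yes e≤sum = ≤-trans (∑-𝟙-≤ e _) e≤sum
... | no  e≰sum =
  let sum<e = ≰⇒> e≰sum
      (p , p≤ , K<α) = shiftedPart>-witness K α (≤-<-trans (m≤m+n _ _) sum<e)
      (q , q≤ , K′<β) = shiftedPart>-witness K′ β (≤-<-trans (m≤n+m _ _) sum<e)
      p+q≤sum = +-mono-≤ p≤ q≤
      K+K′<κ : K + K′ < shiftedPart κ (p + q)
      K+K′<κ = ≤-pred (begin
        suc (suc (K + K′))                ≡⟨ cong suc (+-suc K K′) ⟨
        suc K + suc K′                    ≤⟨ +-mono-≤ K<α K′<β ⟩
        shiftedPart α p + shiftedPart β q ≤⟨ shiftedPart-weyl t p q (≤-<-trans p+q≤sum sum<e) ⟩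
        suc (shiftedPart κ (p + q))       ∎)
      κ-large : ∀ i → p + q ≤ i → ¬ T (shiftedPart κ i ≤ᵇ K + K′)
      κ-large i p+q≤i small = <⇒≱ (<-≤-trans K+K′<κ (shiftedPart-mono κ decr p+q≤i)) (≤ᵇ⇒≤ _ _ small)
  in ≤-trans (∑-𝟙-≤-from e _ κ-large) p+q≤sum
  where open ≤-Reasoning

filter-sum≢0 : ∀ {A : Set} {P : Pred A 0ℓ} (P? : Decidable P) (f : A → ℕ) xs →
               sum (map f (filter P? xs)) ≢ 0 → ∃[ x ] P x × f x ≢ 0
filter-sum≢0 P? f []       sum≢0 = ⊥-elim (sum≢0 refl)
filter-sum≢0 P? f (x ∷ xs) sum≢0 with P? x
... | no  _  = filter-sum≢0 P? f xs sum≢0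
... | yes px with f x ≟ 0
...   | no  fx≢0 = x , px , fx≢0
...   | yes fx≡0 = filter-sum≢0 P? f xs (λ rest≡0 → sum≢0 (cong₂ _+_ fx≡0 rest≡0))

*≢0 : ∀ m n → m * n ≢ 0 → m ≢ 0 × n ≢ 0
*≢0 m n mn≢0 = (λ m≡0 → mn≢0 (cong (_* n) m≡0)) , (λ n≡0 → mn≢0 (trans (cong (m *_) n≡0) (*-zeroʳ m)))

eqVecᵇ⇒≡ : ∀ {n} (u v : Vec ℕ n) → T (eqVecᵇ u v) → u ≡ v
eqVecᵇ⇒≡ []      []      _ = refl
eqVecᵇ⇒≡ (x ∷ u) (y ∷ v) t =
  let (x≡y , u≡v) = Equivalence.to T-∧ t in cong₂ _∷_ (≡ᵇ⇒≡ x y x≡y) (eqVecᵇ⇒≡ u v u≡v)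

shiftedParts≤-multiLR : ∀ {I : Set} {e} (ν : Vec ℕ e) (μ : I → Vec ℕ e) (k : I → ℕ) xs α K →
  multiLR e ν (α ∷ map μ xs) ≢ 0 →
  shiftedParts≤ (K + sum (map k xs)) ν ≤ shiftedParts≤ K α + sum (map (λ j → shiftedParts≤ (k j) (μ j)) xs)
shiftedParts≤-multiLR ν μ k [] α K c≢0 with T? (eqVecᵇ ν α)
... | no  ν≢α = ⊥-elim (c≢0 (if-¬T ν≢α))
... | yes ν≡α rewrite eqVecᵇ⇒≡ ν α ν≡α | +-identityʳ K | +-identityʳ (shiftedParts≤ K α) = ≤-refl
shiftedParts≤-multiLR {e = e} ν μ k (x ∷ xs) α K c≢0
  with filter-sum≢0 (λ κ → T? (decrᵇ κ)) (λ κ → LR e κ α (μ x) * multiLR e ν (κ ∷ map μ xs))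
                    (boxVecs e (sumF e (lookup ν))) c≢0
... | κ , decr , summand≢0 with *≢0 (LR e κ α (μ x)) (multiLR e ν (κ ∷ map μ xs)) summand≢0
... | LR≢0 , rest≢0 = begin
  shiftedParts≤ (K + (k x + sum (map k xs))) ν          ≡⟨ cong (λ n → shiftedParts≤ n ν) (+-assoc K (k x) _) ⟨
  shiftedParts≤ (K + k x + sum (map k xs)) ν            ≤⟨ shiftedParts≤-multiLR ν μ k xs κ (K + k x) rest≢0 ⟩
  shiftedParts≤ (K + k x) κ + rest                      ≤⟨ +-monoˡ-≤ rest (shiftedParts≤-subadditive tableau decr K (k x)) ⟩
  shiftedParts≤ K α + shiftedParts≤ (k x) (μ x) + rest  ≡⟨ +-assoc (shiftedParts≤ K α) _ _ ⟩
  shiftedParts≤ K α + (shiftedParts≤ (k x) (μ x) + rest) ∎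
  where
  open ≤-Reasoning
  rest : ℕ
  rest = sum (map (λ j → shiftedParts≤ (k j) (μ j)) xs)
  tableau : LRTableau e κ α (μ x)
  tableau = LR≢0⇒LRTableau LR≢0

countBelow : ∀ {r} → ℕ → Subset r → ℕ
countBelow zero    _       = 0
countBelow (suc k) []      = 0
countBelow (suc k) (b ∷ J) = 𝟙 b + countBelow k J

countBelow-[] : ∀ k → countBelow k [] ≡ 0
countBelow-[] zero    = refl
countBelow-[] (suc k) = refl

countBelow-0∸ : ∀ {r} c (J : Subset r) → countBelow (0 ∸ c) J ≡ 0
countBelow-0∸ c J = cong (λ m → countBelow m J) (0∸n≡0 c)

countBelow-∸-false : ∀ {r} c k (J : Subset r) → countBelow (k ∸ suc c) J ≡ countBelow (k ∸ c) (false ∷ J)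
countBelow-∸-false c       zero    J = sym (countBelow-0∸ c (false ∷ J))
countBelow-∸-false zero    (suc k) J = refl
countBelow-∸-false (suc c) (suc k) J = countBelow-∸-false c k J

countBelow-∸-true : ∀ {r} c k (J : Subset r) →
                    𝟙 (suc c ≤ᵇ k) + countBelow (k ∸ suc c) J ≡ countBelow (k ∸ c) (true ∷ J)
countBelow-∸-true c       zero    J = sym (countBelow-0∸ c (true ∷ J))
countBelow-∸-true zero    (suc k) J = refl
countBelow-∸-true (suc c) (suc k) J = countBelow-∸-true c k J

infixl 9 _‼ˡ_
_‼ˡ_ : List ℕ → ℕ → ℕ
[]       ‼ˡ _     = 0
(x ∷ xs) ‼ˡ zero  = x
(x ∷ xs) ‼ˡ suc i = xs ‼ˡ i

-- tausAux c J lists c + aₚ − p for the elements a₀ < a₁ < ⋯ of J.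
countBelow-tausAux : ∀ {r} c (J : Subset r) k →
  ∑[ p < length (tausAux c J) ] 𝟙 (suc p + tausAux c J ‼ˡ p ≤ᵇ k) ≡ countBelow (k ∸ c) J
countBelow-tausAux c []          k       = sym (countBelow-[] (k ∸ c))
countBelow-tausAux c (false ∷ J) k       = trans (countBelow-tausAux (suc c) J k) (countBelow-∸-false c k J)
countBelow-tausAux c (true ∷ J)  zero    =
  trans (∑-unfoldˡ (length (tausAux c J)) (λ p → 𝟙 (suc p + tausAux c (true ∷ J) ‼ˡ p ≤ᵇ zero)))
        (trans (countBelow-tausAux c J zero) (trans (countBelow-0∸ c J) (sym (countBelow-0∸ c (true ∷ J)))))
countBelow-tausAux c (true ∷ J)  (suc k) =
  trans (∑-unfoldˡ (length (tausAux c J)) (λ p → 𝟙 (suc p + tausAux c (true ∷ J) ‼ˡ p ≤ᵇ suc k)))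
        (trans (cong (𝟙 (suc c ≤ᵇ suc k) +_) (countBelow-tausAux c J k)) (countBelow-∸-true c (suc k) J))

length-tausAux : ∀ {r} c (J : Subset r) → length (tausAux c J) ≡ ∣ J ∣
length-tausAux c []          = refl
length-tausAux c (true ∷ J)  = cong suc (length-tausAux c J)
length-tausAux c (false ∷ J) = length-tausAux (suc c) J

padTo-‼ : ∀ n xs {q} → q < n → padTo n xs ‼ q ≡ xs ‼ˡ q
padTo-‼ (suc n) []       {zero}  _   = refl
padTo-‼ (suc n) []       {suc q} q<n = padTo-‼ n [] (≤-pred q<n)
padTo-‼ (suc n) (x ∷ xs) {zero}  _   = refl
padTo-‼ (suc n) (x ∷ xs) {suc q} q<n = padTo-‼ n xs (≤-pred q<n)

reverseAcc-‼ˡ-length : ∀ acc xs i → reverseAcc acc xs ‼ˡ (length xs + i) ≡ acc ‼ˡ i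
reverseAcc-‼ˡ-length acc []       i = refl
reverseAcc-‼ˡ-length acc (x ∷ xs) i =
  trans (cong (reverseAcc (x ∷ acc) xs ‼ˡ_) (sym (+-suc (length xs) i))) (reverseAcc-‼ˡ-length (x ∷ acc) xs (suc i))

reverseAcc-‼ˡ : ∀ acc xs p → p < length xs → reverseAcc acc xs ‼ˡ (length xs ∸ suc p) ≡ xs ‼ˡ p
reverseAcc-‼ˡ acc (x ∷ xs) zero    _ =
  trans (cong (reverseAcc (x ∷ acc) xs ‼ˡ_) (sym (+-identityʳ (length xs)))) (reverseAcc-‼ˡ-length (x ∷ acc) xs 0)
reverseAcc-‼ˡ acc (x ∷ xs) (suc p) p<len = reverseAcc-‼ˡ (x ∷ acc) xs p (≤-pred p<len)

shiftedPart-padTo-reverse : ∀ t p → p < length t → shiftedPart (padTo (length t) (reverse t)) p ≡ suc p + t ‼ˡ p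
shiftedPart-padTo-reverse t@(_ ∷ t′) p p<len =
  cong (suc p +_) (trans (padTo-‼ (length t) (reverse t) (s≤s (m∸n≤m (length t′) p))) (reverseAcc-‼ˡ [] t p p<len))

shiftedParts≤-τ : ∀ {r e} k (J : Subset r) → ∣ J ∣ ≡ e → shiftedParts≤ k (τ e J) ≡ countBelow k J
shiftedParts≤-τ k J |J|≡e with trans (length-tausAux 0 J) |J|≡e
... | refl = trans (∑-cong _ (λ p p<e → cong (λ n → 𝟙 (n ≤ᵇ k)) (shiftedPart-padTo-reverse (tausAux 0 J) p p<e)))
                   (countBelow-tausAux 0 J k)

horn-countBelow : ∀ {r e m} (J : Fin (suc m) → Subset r) (L : Subset r) (k : Fin (suc m) → ℕ) {ℓ} →
  (∀ j → ∣ J j ∣ ≡ e) → ∣ L ∣ ≡ e → cSchubert e (suc m) J L ≢ 0 → ℓ ≤ sum (map k (allFin (suc m))) →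
  countBelow ℓ L ≤ sum (map (λ j → countBelow (k j) (J j)) (allFin (suc m)))
horn-countBelow {e = e} {m} J L k {ℓ} |J|≡e |L|≡e c≢0 ℓ≤Σk = begin
  countBelow ℓ L
    ≡⟨ shiftedParts≤-τ ℓ L |L|≡e ⟨
  shiftedParts≤ ℓ (τ e L)
    ≤⟨ shiftedParts≤-mono (τ e L) ℓ≤Σk ⟩
  shiftedParts≤ (sum (map k (allFin (suc m)))) (τ e L)
    ≤⟨ shiftedParts≤-multiLR (τ e L) (λ j → τ e (J j)) k (tabulate fsuc) (τ e (J fzero)) (k fzero) c≢0 ⟩
  sum (map (λ j → shiftedParts≤ (k j) (τ e (J j))) (allFin (suc m)))
    ≡⟨ cong sum (map-cong (λ j → shiftedParts≤-τ (k j) (J j) (|J|≡e j)) (allFin (suc m))) ⟩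
  sum (map (λ j → countBelow (k j) (J j)) (allFin (suc m))) ∎
  where open ≤-Reasoning

ω-𝟙 : ∀ r j a → ω r j a ≡ ℤ.+ 𝟙 (toℕ a <ᵇ j)
ω-𝟙 r j a with toℕ a <ᵇ j
... | true  = refl
... | false = refl

ω-nonneg : ∀ r j a → 0ℤ ℤ.≤ ω r j a
ω-nonneg r j a = subst (0ℤ ℤ.≤_) (sym (ω-𝟙 r j a)) (+≤+ z≤n)

ω-weaklyDecr : ∀ r j → WeaklyDecr (ω r j)
ω-weaklyDecr r j a b a≤b = subst₂ ℤ._≤_ (sym (ω-𝟙 r j b)) (sym (ω-𝟙 r j a))
  (+≤+ (𝟙-mono (λ b<j → <⇒<ᵇ (≤-<-trans a≤b (<ᵇ⇒< (toℕ b) j b<j)))))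

ω-mono : ∀ {r j j′} → j ≤ j′ → ∀ a → ω r j a ℤ.≤ ω r j′ a
ω-mono {r} {j} {j′} j≤j′ a = subst₂ ℤ._≤_ (sym (ω-𝟙 r j a)) (sym (ω-𝟙 r j′ a))
  (+≤+ (𝟙-mono (λ a<j → <⇒<ᵇ (<-≤-trans (<ᵇ⇒< _ _ a<j) j≤j′))))

ω-mono⁻ : ∀ {r j j′} → j ≤ r → (∀ a → ω r j a ℤ.≤ ω r j′ a) → j ≤ j′
ω-mono⁻ {r} {j} {j′} j≤r ω⊆ω′ with j ≤? j′
... | yes j≤j′ = j≤j′
... | no  j≰j′ =
  let j′<r = <-≤-trans (≰⇒> j≰j′) j≤r
      a = fromℕ< j′<r
      ω⊆ω′-at-a = drop‿+≤+ (subst₂ ℤ._≤_ (ω-𝟙 r j a) (ω-𝟙 r j′ a) (ω⊆ω′ a))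
      a<j = subst (_< j) (sym (toℕ-fromℕ< j′<r)) (≰⇒> j≰j′)
  in ⊥-elim (<-irrefl (toℕ-fromℕ< j′<r) (<ᵇ⇒< _ _ (𝟙-mono⁻ ω⊆ω′-at-a (<⇒<ᵇ a<j))))

foldr-+ : ∀ {A : Set} {f : A → ℤ} {g : A → ℕ} → (∀ x → f x ≡ ℤ.+ g x) → ∀ xs →
          foldr (λ x acc → f x ℤ.+ acc) 0ℤ xs ≡ ℤ.+ sum (map g xs)
foldr-+ f≡g []       = refl
foldr-+ f≡g (x ∷ xs) = cong₂ ℤ._+_ (f≡g x) (foldr-+ f≡g xs)

sumℤ-+ : ∀ n {f : Fin n → ℤ} {g : Fin n → ℕ} → (∀ a → f a ≡ ℤ.+ g a) → sumℤ n f ≡ ℤ.+ sum (map g (allFin n))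
sumℤ-+ n f≡g = foldr-+ f≡g (allFin n)

sumℤ-ω : ∀ {r ℓ} → ℓ ≤ r → sumℤ r (ω r ℓ) ≡ ℤ.+ ℓ
sumℤ-ω {r} {ℓ} ℓ≤r = begin
  sumℤ r (ω r ℓ)                                  ≡⟨ sumℤ-+ r (ω-𝟙 r ℓ) ⟩
  ℤ.+ sum (map (λ a → 𝟙 (toℕ a <ᵇ ℓ)) (allFin r)) ≡⟨ cong ℤ.+_ (sum-allFin r (λ _ → refl)) ⟩
  ℤ.+ (∑[ a < r ] 𝟙 (a <ᵇ ℓ))                     ≡⟨ cong ℤ.+_ (trans (∑-<ᵇ r (λ _ → 1) ℓ≤r) (∑-1 ℓ)) ⟩
  ℤ.+ ℓ                                           ∎
  where open ≡-Reasoning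

indicatorBelow : ∀ {r} → Subset r → ℕ → Fin r → ℕ
indicatorBelow J k a = if lookup J a then 𝟙 (toℕ a <ᵇ k) else 0

sum-indicatorBelow : ∀ {r} (J : Subset r) k → sum (map (indicatorBelow J k) (allFin r)) ≡ countBelow k J
sum-indicatorBelow []          zero    = refl
sum-indicatorBelow []          (suc k) = refl
sum-indicatorBelow (true ∷ J)  zero    = trans (sum-allFin-suc (indicatorBelow (true ∷ J) zero)) (sum-indicatorBelow J zero)
sum-indicatorBelow (false ∷ J) zero    = trans (sum-allFin-suc (indicatorBelow (false ∷ J) zero)) (sum-indicatorBelow J zero)
sum-indicatorBelow (b ∷ J)     (suc k) =
  trans (sum-allFin-suc (indicatorBelow (b ∷ J) (suc k))) (cong (𝟙 b +_) (sum-indicatorBelow J k))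

sumOn-ω : ∀ {r} (J : Subset r) k → sumOn J (ω r k) ≡ ℤ.+ countBelow k J
sumOn-ω {r} J k = trans (sumℤ-+ r restrict) (cong ℤ.+_ (sum-indicatorBelow J k))
  where
  restrict : ∀ a → (if lookup J a then ω r k a else 0ℤ) ≡ ℤ.+ indicatorBelow J k a
  restrict a with lookup J a
  ... | true  = ω-𝟙 r k a
  ... | false = refl

ω-horn : ∀ {r e m} (J : Fin (suc m) → Subset r) (L : Subset r) (k : Fin (suc m) → ℕ) {ℓ} →
  (∀ j → ∣ J j ∣ ≡ e) → ∣ L ∣ ≡ e → cSchubert e (suc m) J L ≢ 0 → ℓ ≤ sum (map k (allFin (suc m))) →
  sumOn L (ω r ℓ) ℤ.≤ sumℤ (suc m) (λ j → sumOn (J j) (ω r (k j)))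
ω-horn {m = m} J L k {ℓ} |J|≡e |L|≡e c≢0 ℓ≤Σk =
  subst₂ ℤ._≤_ (sym (sumOn-ω L ℓ)) (sym (sumℤ-+ (suc m) (λ j → sumOn-ω (J j) (k j))))
    (+≤+ (horn-countBelow J L k |J|≡e |L|≡e c≢0 ℓ≤Σk))

lemma5p2 : (r s : ℕ) → 1 ≤ r → 3 ≤ s →
    (k : Fin (s ∸ 1) → ℕ) → (ℓ : ℕ) →
    ((i : Fin (s ∸ 1)) → 1 ≤ k i × k i ≤ r) → 1 ≤ ℓ → ℓ ≤ r →
    EqLR r s (λ i → ω r (k i)) (ω r ℓ)
    ⇔ (((i : Fin (s ∸ 1)) → k i ≤ ℓ) × ℓ ≤ sum (map k (allFin (s ∸ 1))))
lemma5p2 r (suc (suc (suc s))) _ (s≤s (s≤s (s≤s _))) k ℓ k∈[1,r] _ ℓ≤r = mk⇔ necessary sufficient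
  where
  m : ℕ
  m = suc (suc s)

  |ν|≡ℓ : sumℤ r (ω r ℓ) ≡ ℤ.+ ℓ
  |ν|≡ℓ = sumℤ-ω ℓ≤r

  Σ|λ|≡Σk : sumℤ m (λ j → sumℤ r (ω r (k j))) ≡ ℤ.+ sum (map k (allFin m))
  Σ|λ|≡Σk = sumℤ-+ m (λ j → sumℤ-ω (proj₂ (k∈[1,r] j)))

  necessary : EqLR r (suc m) (λ j → ω r (k j)) (ω r ℓ) → ((j : Fin m) → k j ≤ ℓ) × ℓ ≤ sum (map k (allFin m))
  necessary (_ , _ , _ , λ⊆ν , |ν|≤Σ|λ| , _) =
    (λ j → ω-mono⁻ (proj₂ (k∈[1,r] j)) (λ⊆ν j)) , drop‿+≤+ (subst₂ ℤ._≤_ |ν|≡ℓ Σ|λ|≡Σk |ν|≤Σ|λ|)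

  sufficient : ((j : Fin m) → k j ≤ ℓ) × ℓ ≤ sum (map k (allFin m)) → EqLR r (suc m) (λ j → ω r (k j)) (ω r ℓ)
  sufficient (k≤ℓ , ℓ≤Σk) =
      (λ j → ω-weaklyDecr r (k j))
    , ω-weaklyDecr r ℓ
    , (λ j a _ → ω-nonneg r (k j) a)
    , (λ j → ω-mono (k≤ℓ j))
    , subst₂ ℤ._≤_ (sym |ν|≡ℓ) (sym Σ|λ|≡Σk) (+≤+ ℓ≤Σk)
    , (λ e _ _ J L |J|≡e |L|≡e c≡1 → ω-horn J L k |J|≡e |L|≡e (λ c≡0 → 1+n≢0 (trans (sym c≡1) c≡0)) ℓ≤Σk)
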